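{- Let $F_{\mathrm{red}}$ and $F_{\mathrm{blue}}$ be clausal ground formulas and let $T$ be a closed two-sided clausal ground tableau for $F_{\mathrm{red}}$ and $F_{\mathrm{blue}}$. If $N$ is the root of $T$, then (1) $F_{\mathrm{red}} \models \mathrm{ipol}(N) \models \neg F_{\mathrm{blue}}$, and (2) $\mathrm{lit}(\mathrm{ipol}(N)) \subseteq \mathrm{lit}(F_{\mathrm{red}}) \cap \mathrm{lit}(\neg F_{\mathrm{blue}})$.
   Context: We work in first-order logic without equality. A literal is an atom or a negated atom; $\overline{L}$ denotes the complement of literal $L$. A clause is a (possibly empty) disjunction of literals; a clausal formula is a (possibly empty) conjunction of clauses. A formula is ground if it contains no variables and no quantifiers. For a formula $F$, $\mathrm{lit}(F)$ denotes the set of pairs consisting of an atom occurring in $F$ together with the polarity of that occurrence (positive if it is in the scope of an even number of negations, negative otherwise). A clausal tableau for a clausal formula $F$ is a finite ordered tree whose nodes $N$, except the root, carry a literal label $\mathrm{lit}(N)$, such that for every node $N$ having children, the disjunction $\mathrm{clause}(N)$ of the labels of its children (in left-to-right order) is an instance of a clause of $F$. A node $N$ is closed if it has an ancestor $N'$ with $\mathrm{lit}(N') = \overline{\mathrm{lit}(N)}$; for each closed node one such ancestor is fixed and called its target $\mathrm{tgt}(N)$. A tableau is closed if all its leaves are closed, and ground if all literal labels are ground. For clausal formulas $F_{\mathrm{red}}, F_{\mathrm{blue}}$, a two-sided clausal tableau for $F_{\mathrm{red}}$ and $F_{\mathrm{blue}}$ is a clausal tableau for $F_{\mathrm{red}}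 \wedge F_{\mathrm{blue}}$ whose non-root nodes additionally carry a side label $\mathrm{side}(N) \in \{\mathrm{red}, \mathrm{blue}\}$ such that siblings have the same side, and if the children of $N$ have side $S$ then $\mathrm{clause}(N)$ is an instance of a clause of $F_S$. For a node $N$ of a closed two-sided clausal ground tableau, the ground formula $\mathrm{ipol}(N)$ is defined inductively: if $N$ is a leaf then $\mathrm{ipol}(N) = \bot$ if $\mathrm{side}(N)=\mathrm{side}(\mathrm{tgt}(N))=\mathrm{red}$; $\mathrm{ipol}(N)=\mathrm{lit}(N)$ if $\mathrm{side}(N)=\mathrm{red}$ and $\mathrm{side}(\mathrm{tgt}(N))=\mathrm{blue}$; $\mathrm{ipol}(N)=\overline{\mathrm{lit}(N)}$ if $\mathrm{side}(N)=\mathrm{blue}$ and $\mathrm{side}(\mathrm{tgt}(N))=\mathrm{red}$; $\mathrm{ipol}(N)=\top$ if $\mathrm{side}(N)=\mathrm{side}(\mathrm{tgt}(N))=\mathrm{blue}$. If $N$ is an inner node with children $N_1,\dots,N_n$ ($n\ge 1$), then $\mathrm{ipol}(N)=\bigvee_{i=1}^n \mathrm{ipol}(N_i)$ if the children have side red and $\mathrm{ipol}(N)=\bigwedge_{i=1}^n \mathrm{ipol}(N_i)$ if they have side blue. -}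

module Defs where

open import Data.Nat using (ℕ)
open import Data.Bool using (Bool; true; false; not; _∧_; _∨_)
open import Data.List using (List; []; _∷_; map)
open import Data.List.Membership.Propositional using (_∈_)
open import Data.List.Relation.Unary.Any as Any using (Any)
open import Data.Product using (_×_; _,_; proj₁; proj₂)
open import Relation.Binary.PropositionalEquality using (_≡_)

data Term : Set where
  fun : ℕ → List Term → Term

record Atom : Set where
  constructor pred
  field
    symbol : ℕ
    args   : List Term

data Lit : Set where
  pos : Atom → Lit
  neg : Atom → Lit

compl : Lit → Lit
compl (pos a) = neg a
compl (neg a) = pos a

Clause : Set
Clause = List Lit

ClausalFormula : Set
ClausalFormula = List Clause

data Formula : Set where
  atom : Atom → Formula
  ⊤f ⊥f : Formula
  ¬f_ : Formula → Formula
  _∧f_ _∨f_ : Formula → Formula → Formula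

litF : Lit → Formula
litF (pos a) = atom a
litF (neg a) = ¬f atom a

⋁ : List Formula → Formula
⋁ []           = ⊥f
⋁ (f ∷ [])     = f
⋁ (f ∷ g ∷ fs) = f ∨f ⋁ (g ∷ fs)

⋀ : List Formula → Formula
⋀ []           = ⊤f
⋀ (f ∷ [])     = f
⋀ (f ∷ g ∷ fs) = f ∧f ⋀ (g ∷ fs)

clauseF : Clause → Formula
clauseF c = ⋁ (map litF c)

cnfF : ClausalFormula → Formula
cnfF F = ⋀ (map clauseF F)

record Structure : Set₁ where
  field
    D     : Set
    funI  : ℕ → List D → D
    predI : ℕ → List D → Bool

module _ (M : Structure) where
  open Structure M

  mutual
    evalT : Term → D
    evalT (fun f ts) = funI f (evalTs ts)

    evalTs : List Term → List D
    evalTs []       = []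
    evalTs (t ∷ ts) = evalT t ∷ evalTs ts

  evalA : Atom → Bool
  evalA (pred p ts) = predI p (evalTs ts)

  eval : Formula → Bool
  eval (atom a)  = evalA a
  eval ⊤f        = true
  eval ⊥f        = false
  eval (¬f f)    = not (eval f)
  eval (f ∧f g)  = eval f ∧ eval g
  eval (f ∨f g)  = eval f ∨ eval g

_⊨_ : Formula → Formula → Set₁
F ⊨ G = (M : Structure) → eval M F ≡ true → eval M G ≡ true

-- lit(F): atom occurrences with polarity

data Polarity : Set where
  + - : Polarity

flip : Polarity → Polarity
flip + = -
flip - = +

data Occ : Polarity → Atom → Formula → Set where
  here : ∀ {a} → Occ + a (atom a)
  inNot : ∀ {p a f} → Occ (flip p) a f → Occ p a (¬f f)
  inAndˡ : ∀ {p a f g} → Occ p a f → Occ p a (f ∧f g)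
  inAndʳ : ∀ {p a f g} → Occ p a g → Occ p a (f ∧f g)
  inOrˡ : ∀ {p a f g} → Occ p a f → Occ p a (f ∨f g)
  inOrʳ : ∀ {p a f g} → Occ p a g → Occ p a (f ∨f g)

data Side : Set where
  red blue : Side

side : Side → ClausalFormula → ClausalFormula → ClausalFormula
side red  Fr Fb = Fr
side blue Fr Fb = Fb

mutual
  data Tree : Set where
    node : Lit → Children → Tree

  -- children of a node: none, or a nonempty ordered list of siblings,
  -- all carrying the same side label
  data Children : Set where
    none : Children
    kids : Side → Tree → List Tree → Children

labels : Tree → List Tree → List Lit
labels t ts = map (λ { (node l _) → l }) (t ∷ ts)

-- The tableau is the root's children (the root carries no label).
Tableau : Set
Tableau = Children

-- The index `path` lists
-- the (literal, side) labels of the non-root ancestors of the current node,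
-- nearest first.  For each leaf a target ancestor with the complementary
-- literal is fixed (the Any-proof); for each inner node the clause formed by
-- its children's labels is a clause of F_S (ground: instance = the clause).
module _ (Fr Fb : ClausalFormula) where
  mutual
    data ClosedNode (path : List (Lit × Side)) (s : Side) : Tree → Set where
      leaf  : ∀ {l} →
              Any (λ anc → proj₁ anc ≡ compl l) path →
              ClosedNode path s (node l none)
      inner : ∀ {l S t ts} →
              ClosedKids ((l , s) ∷ path) (kids S t ts) →
              ClosedNode path s (node l (kids S t ts))

    data ClosedKids (path : List (Lit × Side)) : Children → Set where
      closedKids : ∀ {S t ts} →
                   labels t ts ∈ side S Fr Fb →
                   ClosedNode path S t →
                   ClosedList path S ts →
                   ClosedKids path (kids S t ts)

    data ClosedList (path : List (Lit × Side)) (S : Side) : List Tree → Set where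
      []  : ClosedList path S []
      _∷_ : ∀ {t ts} → ClosedNode path S t → ClosedList path S ts →
            ClosedList path S (t ∷ ts)

  ClosedTableau : Tableau → Set
  ClosedTableau T = ClosedKids [] T

  ipolLeaf : Side → Side → Lit → Formula
  ipolLeaf red  red  l = ⊥f
  ipolLeaf red  blue l = litF l
  ipolLeaf blue red  l = litF (compl l)
  ipolLeaf blue blue l = ⊤f

  combine : Side → List Formula → Formula
  combine red  = ⋁
  combine blue = ⋀

  mutual
    ipolN : ∀ {path s t} → ClosedNode path s t → Formula
    ipolN {s = s} {t = node l none} (leaf tgt) =
      ipolLeaf s (proj₂ (Any.lookup tgt)) l
    ipolN (inner k) = ipolK k

    ipolK : ∀ {path c} → ClosedKids path c → Formula
    ipolK (closedKids {S = S} _ n ns) = combine S (ipolN n ∷ ipolL ns)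

    ipolL : ∀ {path S ts} → ClosedList path S ts → List Formula
    ipolL []       = []
    ipolL (n ∷ ns) = ipolN n ∷ ipolL ns

  ipolRoot : ∀ {T} → ClosedTableau T → Formula
  ipolRoot = ipolK

module Submission where

-- Each of the three claims is proved for every node by induction on the tableau,
-- carrying an invariant on the branch above the node: for the first, that the
-- red literals on it are true; for the second, that the blue ones are; for the
-- third, that each literal occurs (with its polarity) in the clausal formula of
-- its side. A closed leaf finds its complementary target on that branch, which
-- settles the four leaf cases of ipol. At an inner node, a model of the side's
-- formula makes some child literal true, which is pushed onto the branch of
-- that child; for red children this gives the disjunct of ipol that holds, for
-- blue ones the conjunct of ipol that fails.

open import Defs
open import Data.Bool using (true; false; not; _∧_; _∨_)
open import Data.Bool.Properties using (∨-zeroʳ; ¬-not)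
open import Data.Empty using (⊥-elim)
open import Data.List using (List; []; _∷_; map)
open import Data.List.Membership.Propositional using (_∈_; lose)
open import Data.List.Relation.Unary.All as All using (All; []; _∷_)
open import Data.List.Relation.Unary.All.Properties as All using ()
open import Data.List.Relation.Unary.Any as Any using (Any; here; there)
open import Data.List.Relation.Unary.Any.Properties as Any using ()
open import Data.Product using (_×_; _,_; proj₁; proj₂)
open import Data.Sum using (_⊎_; inj₁; inj₂; [_,_]′)
open import Function using (_∘_)
open import Relation.Nullary using (¬_)
open import Relation.Binary.PropositionalEquality using (_≡_; refl; sym; trans; cong)

∨-true⁻ : ∀ {b c} → b ∨ c ≡ true → b ≡ true ⊎ c ≡ true
∨-true⁻ {true}  _ = inj₁ refl
∨-true⁻ {false} h = inj₂ h

∧-true⁻ : ∀ {b c} → b ∧ c ≡ true → b ≡ true × c ≡ true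
∧-true⁻ {true} h = refl , h

_⊩_ : Structure → Formula → Set
M ⊩ f = eval M f ≡ true

module _ {M : Structure} where

  ⊩-⋁⁺ : ∀ {fs} → Any (M ⊩_) fs → M ⊩ ⋁ fs
  ⊩-⋁⁺ {_ ∷ []}    (here h)  = h
  ⊩-⋁⁺ {_ ∷ _ ∷ _} (here h)  rewrite h = refl
  ⊩-⋁⁺ {f ∷ _ ∷ _} (there h) rewrite ⊩-⋁⁺ h = ∨-zeroʳ (eval M f)

  ⊩-⋁⁻ : ∀ fs → M ⊩ ⋁ fs → Any (M ⊩_) fs
  ⊩-⋁⁻ (f ∷ [])           h = here h
  ⊩-⋁⁻ (f ∷ fs@(_ ∷ _))   h = [ here , there ∘ ⊩-⋁⁻ fs ]′ (∨-true⁻ h)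

  ⊩-⋀⁺ : ∀ {fs} → All (M ⊩_) fs → M ⊩ ⋀ fs
  ⊩-⋀⁺ []                   = refl
  ⊩-⋀⁺ {_ ∷ []}    (h ∷ [])  = h
  ⊩-⋀⁺ {_ ∷ _ ∷ _} (h ∷ hs)  rewrite h = ⊩-⋀⁺ hs

  ⊩-⋀⁻ : ∀ fs → M ⊩ ⋀ fs → All (M ⊩_) fs
  ⊩-⋀⁻ []                 h = []
  ⊩-⋀⁻ (f ∷ [])           h = h ∷ []
  ⊩-⋀⁻ (f ∷ fs@(_ ∷ _))   h = let f-holds , fs-hold = ∧-true⁻ h
                              in  f-holds ∷ ⊩-⋀⁻ fs fs-hold

  ⊩-cnfF⁻ : ∀ {F c} → M ⊩ cnfF F → c ∈ F → Any (λ l → M ⊩ litF l) c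
  ⊩-cnfF⁻ {F} M⊩F c∈F =
    Any.map⁻ (⊩-⋁⁻ _ (All.lookup (All.map⁻ (⊩-⋀⁻ (map clauseF F) M⊩F)) c∈F))

  ⊩-compl : ∀ l → M ⊩ litF l → ¬ (M ⊩ litF (compl l))
  ⊩-compl (pos a) h h′ with () ← trans (sym h′) (cong not h)
  ⊩-compl (neg a) h h′ with () ← trans (sym h) (cong not h′)

  ⊩-¬f⁺ : ∀ {f} → ¬ (M ⊩ f) → M ⊩ (¬f f)
  ⊩-¬f⁺ h = cong not (¬-not h)

_⊆lit_ : Formula → Formula → Set
f ⊆lit g = ∀ {p a} → Occ p a f → Occ p a g

module _ {p : Polarity} {a : Atom} where

  Occ-⋁⁺ : ∀ {fs} → Any (Occ p a) fs → Occ p a (⋁ fs)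
  Occ-⋁⁺ {_ ∷ []}    (here o)  = o
  Occ-⋁⁺ {_ ∷ _ ∷ _} (here o)  = inOrˡ o
  Occ-⋁⁺ {_ ∷ _ ∷ _} (there o) = inOrʳ (Occ-⋁⁺ o)

  Occ-⋁⁻ : ∀ fs → Occ p a (⋁ fs) → Any (Occ p a) fs
  Occ-⋁⁻ (f ∷ [])           o         = here o
  Occ-⋁⁻ (f ∷ fs@(_ ∷ _))   (inOrˡ o) = here o
  Occ-⋁⁻ (f ∷ fs@(_ ∷ _))   (inOrʳ o) = there (Occ-⋁⁻ fs o)

  Occ-⋀⁺ : ∀ {fs} → Any (Occ p a) fs → Occ p a (⋀ fs)
  Occ-⋀⁺ {_ ∷ []}    (here o)  = o
  Occ-⋀⁺ {_ ∷ _ ∷ _} (here o)  = inAndˡ o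
  Occ-⋀⁺ {_ ∷ _ ∷ _} (there o) = inAndʳ (Occ-⋀⁺ o)

  Occ-⋀⁻ : ∀ fs → Occ p a (⋀ fs) → Any (Occ p a) fs
  Occ-⋀⁻ (f ∷ [])           o          = here o
  Occ-⋀⁻ (f ∷ fs@(_ ∷ _))   (inAndˡ o) = here o
  Occ-⋀⁻ (f ∷ fs@(_ ∷ _))   (inAndʳ o) = there (Occ-⋀⁻ fs o)

litF-⊆lit-cnfF : ∀ {F c l} → c ∈ F → l ∈ c → litF l ⊆lit cnfF F
litF-⊆lit-cnfF c∈F l∈c o =
  Occ-⋀⁺ (Any.map⁺ (lose c∈F (Occ-⋁⁺ (Any.map⁺ (lose l∈c o)))))

compl-⊆lit-¬ : ∀ l {f} → litF l ⊆lit f → litF (compl l) ⊆lit (¬f f)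
compl-⊆lit-¬ (pos b) l⊆f {p = - } (inNot here) = inNot (l⊆f here)
compl-⊆lit-¬ (neg b) l⊆f            here         = inNot (l⊆f (inNot here))

⊆lit-¬-from-compl : ∀ l {f} → litF (compl l) ⊆lit f → litF l ⊆lit (¬f f)
⊆lit-¬-from-compl (pos b) l̅⊆f            here         = inNot (l̅⊆f (inNot here))
⊆lit-¬-from-compl (neg b) l̅⊆f {p = - } (inNot here) = inNot (l̅⊆f here)

target-invariant : ∀ {P : Lit × Side → Set} {path l} → All P path →
                   (tgt : Any (λ anc → proj₁ anc ≡ compl l) path) →
                   P (compl l , proj₂ (Any.lookup tgt))
target-invariant (p ∷ _)  (here refl) = p
target-invariant (_ ∷ ps) (there tgt) = target-invariant ps tgt

module _ (Fr Fb : ClausalFormula) where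

  Node : List (Lit × Side) → Side → Tree → Set
  Node = ClosedNode Fr Fb

  Siblings : List (Lit × Side) → Side → List Tree → Set
  Siblings = ClosedList Fr Fb

  ipols : ∀ {path S t ts} → Node path S t → Siblings path S ts → List Formula
  ipols n ns = ipolN Fr Fb n ∷ ipolL Fr Fb ns

  TrueIf : Structure → Side → Lit × Side → Set
  TrueIf M S (l , s) = s ≡ S → M ⊩ litF l

  module _ {M : Structure} (M⊩Fr : M ⊩ cnfF Fr) where

    ipolLeaf-holds : ∀ s s′ l → TrueIf M red (l , s) → TrueIf M red (compl l , s′) →
                     M ⊩ ipolLeaf Fr Fb s s′ l
    ipolLeaf-holds red  red  l h h̅ = ⊥-elim (⊩-compl l (h refl) (h̅ refl))
    ipolLeaf-holds red  blue l h _ = h refl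
    ipolLeaf-holds blue red  l _ h̅ = h̅ refl
    ipolLeaf-holds blue blue l _ _ = refl

    mutual
      ipolN-holds : ∀ {path s l c} (n : Node path s (node l c)) →
                    All (TrueIf M red) ((l , s) ∷ path) → M ⊩ ipolN Fr Fb n
      ipolN-holds {s = s} {l} (leaf tgt) (h ∷ hs) =
        ipolLeaf-holds s _ l h (target-invariant hs tgt)
      ipolN-holds (inner k) hs = ipolK-holds k hs

      ipolK-holds : ∀ {path c} (k : ClosedKids Fr Fb path c) → All (TrueIf M red) path →
                    M ⊩ ipolK Fr Fb k
      ipolK-holds (closedKids {S = red}  cl n ns) hs =
        ⊩-⋁⁺ (some-ipol-holds n ns hs (⊩-cnfF⁻ M⊩Fr cl))
      ipolK-holds (closedKids {S = blue} _  n ns) hs =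
        ⊩-⋀⁺ (all-ipol-hold n ns hs)

      some-ipol-holds : ∀ {path t ts} (n : Node path red t) (ns : Siblings path red ts) →
                        All (TrueIf M red) path → Any (λ l → M ⊩ litF l) (labels t ts) →
                        Any (M ⊩_) (ipols n ns)
      some-ipol-holds {t = node _ _} n ns       hs (here h)   =
        here (ipolN-holds n ((λ _ → h) ∷ hs))
      some-ipol-holds                n (m ∷ ms) hs (there h)  = there (some-ipol-holds m ms hs h)
      some-ipol-holds                n []       hs (there ())

      all-ipol-hold : ∀ {path t ts} (n : Node path blue t) (ns : Siblings path blue ts) →
                      All (TrueIf M red) path → All (M ⊩_) (ipols n ns)
      all-ipol-hold {t = node _ _} n []       hs = ipolN-holds n ((λ ()) ∷ hs) ∷ []
      all-ipol-hold {t = node _ _} n (m ∷ ms) hs =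
        ipolN-holds n ((λ ()) ∷ hs) ∷ all-ipol-hold m ms hs

  module _ {M : Structure} (M⊩Fb : M ⊩ cnfF Fb) where

    ipolLeaf-fails : ∀ s s′ l → TrueIf M blue (l , s) → TrueIf M blue (compl l , s′) →
                     ¬ (M ⊩ ipolLeaf Fr Fb s s′ l)
    ipolLeaf-fails red  red  l _ _ ()
    ipolLeaf-fails red  blue l _ h̅ ip = ⊩-compl l ip (h̅ refl)
    ipolLeaf-fails blue red  l h _ ip = ⊩-compl l (h refl) ip
    ipolLeaf-fails blue blue l h h̅ _  = ⊩-compl l (h refl) (h̅ refl)

    mutual
      ipolN-fails : ∀ {path s l c} (n : Node path s (node l c)) →
                    All (TrueIf M blue) ((l , s) ∷ path) → ¬ (M ⊩ ipolN Fr Fb n)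
      ipolN-fails {s = s} {l} (leaf tgt) (h ∷ hs) =
        ipolLeaf-fails s _ l h (target-invariant hs tgt)
      ipolN-fails (inner k) hs = ipolK-fails k hs

      ipolK-fails : ∀ {path c} (k : ClosedKids Fr Fb path c) → All (TrueIf M blue) path →
                    ¬ (M ⊩ ipolK Fr Fb k)
      ipolK-fails (closedKids {S = red}  _  n ns) hs ip = no-ipol-holds n ns hs (⊩-⋁⁻ _ ip)
      ipolK-fails (closedKids {S = blue} cl n ns) hs ip =
        not-all-ipol-hold n ns hs (⊩-cnfF⁻ M⊩Fb cl) (⊩-⋀⁻ _ ip)

      no-ipol-holds : ∀ {path t ts} (n : Node path red t) (ns : Siblings path red ts) →
                      All (TrueIf M blue) path → ¬ Any (M ⊩_) (ipols n ns)
      no-ipol-holds {t = node _ _} n ns       hs (here ip)  = ipolN-fails n ((λ ()) ∷ hs) ip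
      no-ipol-holds                n (m ∷ ms) hs (there ip) = no-ipol-holds m ms hs ip
      no-ipol-holds                n []       hs (there ())

      not-all-ipol-hold : ∀ {path t ts} (n : Node path blue t) (ns : Siblings path blue ts) →
                          All (TrueIf M blue) path → Any (λ l → M ⊩ litF l) (labels t ts) →
                          ¬ All (M ⊩_) (ipols n ns)
      not-all-ipol-hold {t = node _ _} n ns       hs (here h)  (ip ∷ _)   =
        ipolN-fails n ((λ _ → h) ∷ hs) ip
      not-all-ipol-hold                n (m ∷ ms) hs (there h) (_ ∷ ips) =
        not-all-ipol-hold m ms hs h ips
      not-all-ipol-hold                n []       hs (there ()) _

  InSide : Lit × Side → Set
  InSide (l , s) = litF l ⊆lit cnfF (side s Fr Fb)

  Shared : Formula → Set
  Shared f = ∀ {p a} → Occ p a f → Occ p a (cnfF Fr) × Occ p a (¬f cnfF Fb)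

  Occ-combine⁻ : ∀ {p a} S fs → Occ p a (combine Fr Fb S fs) → Any (Occ p a) fs
  Occ-combine⁻ red  = Occ-⋁⁻
  Occ-combine⁻ blue = Occ-⋀⁻

  ipolLeaf-shared : ∀ s s′ l → InSide (l , s) → InSide (compl l , s′) →
                    Shared (ipolLeaf Fr Fb s s′ l)
  ipolLeaf-shared red  red  _ _  _  ()
  ipolLeaf-shared red  blue l l⊆ l̅⊆ o = l⊆ o , ⊆lit-¬-from-compl l l̅⊆ o
  ipolLeaf-shared blue red  l l⊆ l̅⊆ o = l̅⊆ o , compl-⊆lit-¬ l l⊆ o
  ipolLeaf-shared blue blue _ _  _  ()

  mutual
    ipolN-shared : ∀ {path s l c} (n : Node path s (node l c)) →
                   All InSide ((l , s) ∷ path) → Shared (ipolN Fr Fb n)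
    ipolN-shared {s = s} {l} (leaf tgt) (h ∷ hs) =
      ipolLeaf-shared s _ l h (target-invariant hs tgt)
    ipolN-shared (inner k) hs = ipolK-shared k hs

    ipolK-shared : ∀ {path c} (k : ClosedKids Fr Fb path c) → All InSide path →
                   Shared (ipolK Fr Fb k)
    ipolK-shared (closedKids {S = S} cl n ns) hs o
      with sh , o′ ← All.lookupAny (all-ipol-shared n ns (litF-⊆lit-cnfF cl) hs)
                                   (Occ-combine⁻ S _ o)
      = sh o′

    all-ipol-shared : ∀ {path S t ts} (n : Node path S t) (ns : Siblings path S ts) →
                      (∀ {l} → l ∈ labels t ts → InSide (l , S)) → All InSide path →
                      All Shared (ipols n ns)
    all-ipol-shared {t = node _ _} n []       inS hs =
      ipolN-shared n (inS (here refl) ∷ hs) ∷ []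
    all-ipol-shared {t = node _ _} n (m ∷ ms) inS hs =
      ipolN-shared n (inS (here refl) ∷ hs) ∷ all-ipol-shared m ms (inS ∘ there) hs

lemma1 : (Fr Fb : ClausalFormula) (T : Tableau) (c : ClosedTableau Fr Fb T) →
         (cnfF Fr ⊨ ipolRoot Fr Fb c) ×
         (ipolRoot Fr Fb c ⊨ (¬f cnfF Fb)) ×
         (∀ p a → Occ p a (ipolRoot Fr Fb c) →
            Occ p a (cnfF Fr) × Occ p a (¬f cnfF Fb))
lemma1 Fr Fb T c =
  (λ M M⊩Fr → ipolK-holds Fr Fb M⊩Fr c []) ,
  (λ M M⊩ipol → ⊩-¬f⁺ {f = cnfF Fb} λ M⊩Fb →
                   ipolK-fails Fr Fb M⊩Fb c [] M⊩ipol) ,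
  (λ p a → ipolK-shared Fr Fb c [])
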